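{- Let $\mathbb A=(A,+)$ be a cancellative semigroup, and let $X,Y\subseteq A$ be such that $X+2Y\not\subseteq X+Y$ and $\langle Y\rangle$ is commutative. Fix $z\in(X+2Y)\setminus(X+Y)$, and define $$\tilde Y_z:=\{y\in Y: z\in X+Y+y\},\qquad Y_z:=Y\setminus\tilde Y_z.$$ Then: (i) $(X+Y_z)\cup(z-\tilde Y_z)\subseteq X+Y$; (ii) $(X+Y_z)\cap(z-\tilde Y_z)=\emptyset$; (iii) $|z-\tilde Y_z|\ge|\tilde Y_z|$; (iv) $|X+Y|+|Y_z|\ge|X+Y_z|+|Y|$.
   Context: The semigroup is written additively but need not be commutative. Cancellative: for every $c\in A$ the maps $x\mapsto x+c$ and $x\mapsto c+x$ are injective. $X+Y:=\{x+y:x\in X,y\in Y\}$, $2Y:=Y+Y$, $X+Y+y:=\{w+y: w\in X+Y\}$. $\langle Y\rangle$ is the subsemigroup generated by $Y$. For $z\in A$ and $W\subseteq A$, $z-W:=\{u\in A: z\in u+W\}$ (this is defined without inverses and may be empty). Cardinalities may be infinite. -}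

module Defs where

open import Level using (0ℓ)
open import Data.Product using (Σ; ∃; ∃₂; _×_; _,_)
open import Data.Sum using (_⊎_; inj₁; inj₂)
open import Relation.Nullary using (¬_)
open import Relation.Unary using (Pred; _∈_; _∉_)
open import Relation.Binary.PropositionalEquality using (_≡_)
open import Algebra.Core using (Op₂)

-- Cardinal comparison |S| ≤ |T| for subsets (of possibly different types):
-- an injection from the elements of S into the elements of T.
-- (f may inspect the membership proof, but injectivity is on elements.)
_≲_ : {B C : Set} → Pred B 0ℓ → Pred C 0ℓ → Set
_≲_ {B} {C} S T =
  Σ ((b : B) → b ∈ S → C) λ f →
    ((b : B) (p : b ∈ S) → f b p ∈ T) ×
    ((b b′ : B) (p : b ∈ S) (p′ : b′ ∈ S) → f b p ≡ f b′ p′ → b ≡ b′)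

-- Disjoint union of two subsets of A, as a subset of A ⊎ A;
-- its cardinality is the cardinal sum |S| + |T|.
_⊕_ : {A : Set} → Pred A 0ℓ → Pred A 0ℓ → Pred (A ⊎ A) 0ℓ
(S ⊕ T) (inj₁ a) = a ∈ S
(S ⊕ T) (inj₂ a) = a ∈ T

module SemigroupSets {A : Set} (_+_ : Op₂ A) where

  _+ₛ_ : Pred A 0ℓ → Pred A 0ℓ → Pred A 0ℓ
  (X +ₛ Y) a = ∃₂ λ x y → x ∈ X × y ∈ Y × a ≡ x + y

  2· : Pred A 0ℓ → Pred A 0ℓ
  2· Y = Y +ₛ Y

  _+ₑ_ : Pred A 0ℓ → A → Pred A 0ℓ
  (W +ₑ y) a = ∃ λ w → w ∈ W × a ≡ w + y

  _-ₛ_ : A → Pred A 0ℓ → Pred A 0ℓ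
  (z -ₛ W) u = ∃ λ w → w ∈ W × z ≡ u + w

  data ⟨_⟩ (Y : Pred A 0ℓ) : Pred A 0ℓ where
    gen : ∀ {y} → y ∈ Y → y ∈ ⟨ Y ⟩
    add : ∀ {u v} → u ∈ ⟨ Y ⟩ → v ∈ ⟨ Y ⟩ → (u + v) ∈ ⟨ Y ⟩

  CommutativeSet : Pred A 0ℓ → Set
  CommutativeSet S = ∀ u v → u ∈ S → v ∈ S → u + v ≡ v + u

  Ỹ : Pred A 0ℓ → Pred A 0ℓ → A → Pred A 0ℓ
  Ỹ X Y z y = y ∈ Y × z ∈ ((X +ₛ Y) +ₑ y)

  Yz : Pred A 0ℓ → Pred A 0ℓ → A → Pred A 0ℓ
  Yz X Y z y = y ∈ Y × y ∉ Ỹ X Y z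

-- Every y ∈ Ỹ_z is witnessed by some s ∈ X + Y with z = s + y, and y ↦ s is an
-- injection of Ỹ_z into z − Ỹ_z (left cancellation); right cancellation puts
-- z − Ỹ_z inside X + Y. If u = x + y with y ∈ Y_z also had z = u + w, w ∈ Ỹ_z,
-- then commuting y and w gives z = (x + w) + y ∈ X + Y + y, i.e. y ∈ Ỹ_z;
-- so (ii) holds. For (iv), send X + Y_z identically into X + Y, keep Y_z, and
-- send Ỹ_z into the part z − Ỹ_z of X + Y, which misses X + Y_z.
module Submission where

open import Defs
open import Level using (0ℓ)
open import Data.Product using (_×_; _,_; proj₁; proj₂)
open import Data.Sum using (_⊎_; inj₁; inj₂)
open import Data.Sum.Properties using (inj₁-injective; inj₂-injective)
open import Data.Empty using (⊥-elim)
open import Relation.Nullary using (¬_; Dec; yes; no)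
open import Relation.Unary using (Pred; _∈_; _∉_; _⊆_; _∪_; _∩_; ∁; Empty)
open import Relation.Binary.PropositionalEquality using (_≡_; _≢_; refl; sym; trans; cong; subst; module ≡-Reasoning)
open import Algebra.Core using (Op₂)
open import Algebra.Structures using (IsSemigroup)
open import Algebra.Definitions using (Cancellative; LeftCancellative; RightCancellative; Associative)
open import Axiom.ExcludedMiddle using (ExcludedMiddle)

⊕-≲-exchange : ExcludedMiddle 0ℓ → {A : Set} {S T D W Y : Pred A 0ℓ} →
               S ⊆ T → D ⊆ T → Empty (S ∩ D) → W ≲ D →
               (S ⊕ Y) ≲ (T ⊕ (Y ∩ ∁ W))
⊕-≲-exchange em {A} {S} {T} {D} {W} {Y} S⊆T D⊆T S∩D=∅ (f , f∈D , f-inj) =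
  g , g∈ , g-inj
  where
  classify : (y : A) → Dec (y ∈ W) → A ⊎ A
  classify y (yes y∈W) = inj₁ (f y y∈W)
  classify y (no _)    = inj₂ y

  g : (b : A ⊎ A) → b ∈ (S ⊕ Y) → A ⊎ A
  g (inj₁ s) _ = inj₁ s
  g (inj₂ y) _ = classify y em

  classify∈ : ∀ y → y ∈ Y → (d : Dec (y ∈ W)) → classify y d ∈ (T ⊕ (Y ∩ ∁ W))
  classify∈ y _   (yes y∈W) = D⊆T (f∈D y y∈W)
  classify∈ y y∈Y (no y∉W)  = y∈Y , y∉W

  g∈ : ∀ b (p : b ∈ (S ⊕ Y)) → g b p ∈ (T ⊕ (Y ∩ ∁ W))
  g∈ (inj₁ s) s∈S = S⊆T s∈S
  g∈ (inj₂ y) y∈Y = classify∈ y y∈Y em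

  classify-inj : ∀ y y′ (d : Dec (y ∈ W)) (d′ : Dec (y′ ∈ W)) →
                 classify y d ≡ classify y′ d′ → y ≡ y′
  classify-inj y y′ (yes p) (yes p′) e = f-inj y y′ p p′ (inj₁-injective e)
  classify-inj y y′ (no _)  (no _)   e = inj₂-injective e
  classify-inj y y′ (yes _) (no _)   ()
  classify-inj y y′ (no _)  (yes _)  ()

  classify-∉S : ∀ s y → s ∈ S → (d : Dec (y ∈ W)) → inj₁ s ≢ classify y d
  classify-∉S s y s∈S (yes y∈W) e = S∩D=∅ s (s∈S , subst (_∈ D) (sym (inj₁-injective e)) (f∈D y y∈W))
  classify-∉S s y s∈S (no _)    ()

  g-inj : ∀ b b′ (p : b ∈ (S ⊕ Y)) (p′ : b′ ∈ (S ⊕ Y)) → g b p ≡ g b′ p′ → b ≡ b′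
  g-inj (inj₁ s) (inj₁ s′) _ _ e = e
  g-inj (inj₂ y) (inj₂ y′) _ _ e = cong inj₂ (classify-inj y y′ em em e)
  g-inj (inj₁ s) (inj₂ y)  s∈S _ e = ⊥-elim (classify-∉S s y s∈S em e)
  g-inj (inj₂ y) (inj₁ s)  _ s∈S e = ⊥-elim (classify-∉S s y s∈S em (sym e))

module _ {A : Set} (_+_ : Op₂ A) where
  open SemigroupSets _+_

  +ₛ-monoʳ : {X Y Y′ : Pred A 0ℓ} → Y′ ⊆ Y → (X +ₛ Y′) ⊆ (X +ₛ Y)
  +ₛ-monoʳ Y′⊆Y (x , y , x∈X , y∈Y′ , eq) = x , y , x∈X , Y′⊆Y y∈Y′ , eq

  -ₛ-⊆ : RightCancellative _≡_ _+_ → {V W : Pred A 0ℓ} {z : A} →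
         (∀ {w} → w ∈ W → z ∈ (V +ₑ w)) → (z -ₛ W) ⊆ V
  -ₛ-⊆ cancʳ {V} completes {u} (w , w∈W , z≡u+w) with completes w∈W
  ... | s , s∈V , z≡s+w = subst (_∈ V) (cancʳ w s u (trans (sym z≡s+w) z≡u+w)) s∈V

  ≲-ₛ : LeftCancellative _≡_ _+_ → {V W : Pred A 0ℓ} {z : A} →
        (∀ {w} → w ∈ W → z ∈ (V +ₑ w)) → W ≲ (z -ₛ W)
  ≲-ₛ cancˡ {W = W} {z} completes = complement , complement∈ , complement-inj
    where
    complement : (w : A) → w ∈ W → A
    complement w w∈W = proj₁ (completes w∈W)

    complement∈ : ∀ w (p : w ∈ W) → complement w p ∈ (z -ₛ W)
    complement∈ w w∈W = w , w∈W , proj₂ (proj₂ (completes w∈W))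

    complement-inj : ∀ w w′ (p : w ∈ W) (p′ : w′ ∈ W) →
                     complement w p ≡ complement w′ p′ → w ≡ w′
    complement-inj w w′ w∈W w′∈W s≡s′ with completes w∈W | completes w′∈W
    ... | s , _ , z≡s+w | s′ , _ , z≡s′+w′ =
      cancˡ s w w′ (trans (sym z≡s+w) (trans z≡s′+w′ (cong (_+ w′) (sym s≡s′))))

  Yz-∩-Ỹ-empty : Associative _≡_ _+_ → {X Y : Pred A 0ℓ} {z : A} →
                 (∀ {u v} → u ∈ Y → v ∈ Y → u + v ≡ v + u) →
                 Empty ((X +ₛ Yz X Y z) ∩ (z -ₛ Ỹ X Y z))
  Yz-∩-Ỹ-empty assoc {z = z} comm _ ((x , y , x∈X , (y∈Y , y∉Ỹ) , refl) , (w , (w∈Y , _) , z≡)) =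
    y∉Ỹ (y∈Y , x + w , (x , w , x∈X , w∈Y , refl) , z≡x+w+y)
    where
    open ≡-Reasoning
    z≡x+w+y : z ≡ (x + w) + y
    z≡x+w+y = begin
      z             ≡⟨ z≡ ⟩
      (x + y) + w   ≡⟨ assoc x y w ⟩
      x + (y + w)   ≡⟨ cong (x +_) (comm y∈Y w∈Y) ⟩
      x + (w + y)   ≡⟨ sym (assoc x w y) ⟩
      (x + w) + y   ∎

proposition11 : ExcludedMiddle 0ℓ →
    (A : Set) (_+_ : Op₂ A) → IsSemigroup _≡_ _+_ → Cancellative _≡_ _+_ →
    let open SemigroupSets _+_ in
    (X Y : Pred A 0ℓ) → ¬ ((X +ₛ 2· Y) ⊆ (X +ₛ Y)) → CommutativeSet ⟨ Y ⟩ →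
    (z : A) → z ∈ (X +ₛ 2· Y) → z ∉ (X +ₛ Y) →
    (((X +ₛ Yz X Y z) ∪ (z -ₛ Ỹ X Y z)) ⊆ (X +ₛ Y))
    × Empty ((X +ₛ Yz X Y z) ∩ (z -ₛ Ỹ X Y z))
    × (Ỹ X Y z ≲ (z -ₛ Ỹ X Y z))
    × (((X +ₛ Yz X Y z) ⊕ Y) ≲ ((X +ₛ Y) ⊕ Yz X Y z))
proposition11 em A _+_ isSemigroup (cancˡ , cancʳ) X Y _ comm z _ _ =
  union⊆ , disjoint , Ỹ≲ , ⊕-≲-exchange em Yz⊆ difference⊆ disjoint Ỹ≲
  where
  open SemigroupSets _+_
  open IsSemigroup isSemigroup using (assoc)

  Yz⊆ : (X +ₛ Yz X Y z) ⊆ (X +ₛ Y)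
  Yz⊆ = +ₛ-monoʳ _+_ proj₁

  difference⊆ : (z -ₛ Ỹ X Y z) ⊆ (X +ₛ Y)
  difference⊆ = -ₛ-⊆ _+_ cancʳ proj₂

  union⊆ : ((X +ₛ Yz X Y z) ∪ (z -ₛ Ỹ X Y z)) ⊆ (X +ₛ Y)
  union⊆ (inj₁ p) = Yz⊆ p
  union⊆ (inj₂ p) = difference⊆ p

  disjoint : Empty ((X +ₛ Yz X Y z) ∩ (z -ₛ Ỹ X Y z))
  disjoint = Yz-∩-Ỹ-empty _+_ assoc (λ u∈Y v∈Y → comm _ _ (gen u∈Y) (gen v∈Y))

  Ỹ≲ : Ỹ X Y z ≲ (z -ₛ Ỹ X Y z)
  Ỹ≲ = ≲-ₛ _+_ cancˡ proj₂
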